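{- Let $P$ be a length-$n$ read-once branching program over alphabet $[k]$ ($k\ge2$), with rectangle labels $R(v)$ and collections $\mathcal R_t$ as defined in the context. Then: (1) $\mathcal R_0=\{[0,0]^{k-1}\}$, and for every $0\le t\le n-1$ and every $R\in\mathcal R_t$, each of the sets $R,\ R+e_1,\dots,R+e_{k-1}$ is contained in some rectangle in $\mathcal R_{t+1}$; (2) if $P$ has width $w$ then $|\mathcal R_t|\le w$ for all $0\le t\le n$; (3) if $P$ computes $\mathsf{ApproxCount}_{k\text{ -counter}}[n,\Delta]$, then every rectangle $[a_1,b_1]\times\cdots\times[a_{k-1},b_{k-1}]\in\mathcal R_n$ satisfies $b_j-a_j\le2\Delta$ for all $j\in[k-1]$.
   Context: A length-$n$ read-once branching program (ROBP) over a finite alphabet $\Sigma$ is a directed layered multigraph with layers $V_0,\dots,V_n$, $V_0=\{v_{\mathrm{start}}\}$; for $0\le i\le n-1$ each vertex of $V_i$ has $|\Sigma|$ outgoing edges into $V_{i+1}$ labeled by distinct elements of $\Sigma$; vertices of $V_n$ are labeled with outputs; every vertex is reachable by some input. An input $x\in\Sigma^n$ follows the path from $v_{\mathrm{start}}$ using at step $i$ the edge labeled $x_i$; the program outputs the label of the final vertex; a prefix $(x_1,\dots,x_t)$ reaches the vertex of $V_t$ on this path. Width is $\max_i|V_i|$. $\mathsf{ApproxCount}_{k\text{ -counter}}[n,\Delta]$: on input $x\in[k]^n$, output reals $(\hat S_1,\dots,\hat S_k)$ with $|\hat S_j-\#\{i:x_i=j\}|\le\Delta$ for all $j$; $P$ computes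 it if its output is valid on every input. Rectangle labeling: for $v\in V_t$, $R(v)=[a_1,b_1]\times\cdots\times[a_{k-1},b_{k-1}]$ where, for $j\in[k-1]$, $a_j$ and $b_j$ are the minimum and maximum of $\#\{i\in[t]:x_i=j\}$ over all prefixes $(x_1,\dots,x_t)\in[k]^t$ reaching $v$; $\mathcal R_t=\{R(v):v\in V_t\}$. For $S\subseteq\mathbb R^{k-1}$ and a vector $u$, $S+u=\{s+u:s\in S\}$; $e_1,\dots,e_{k-1}$ is the standard basis.
   Formalization: The outputs $(\hat S_1,\dots,\hat S_k)$ and Δ are rational rather than real, and the rectangles are taken as sets of points of ℚ^(k-1) instead of ℝ^(k-1). -}

module Defs where

open import Data.Nat using (ℕ; zero; suc; _≤_; _<_; s≤s; z≤n)
open import Data.Nat.Properties using (<⇒≤; ≤-refl)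
open import Data.Fin using (Fin; inject₁; _≟_)
open import Data.Vec using (Vec; []; init; last; count)
open import Data.Integer using (+_)
open import Data.Rational using (ℚ; _/_; _+_; _-_; ∣_∣; 0ℚ; 1ℚ) renaming (_≤_ to _≤ℚ_; _*_ to _*ℚ_)
open import Data.Product using (Σ; ∃; _×_; _,_)
open import Relation.Binary.PropositionalEquality using (_≡_)
open import Relation.Nullary using (yes; no)

-- Layer t (0 ≤ t ≤ n) is Fin (size t); layers with t > n are irrelevant.
-- Edges out of a vertex of layer t < n are given by a transition function
-- (one edge per letter, labelled by that letter).
record Layers (n k : ℕ) (O : Set) : Set where
  field
    size   : ℕ → ℕ
    start  : Fin (size 0)
    start-unique : ∀ (v : Fin (size 0)) → v ≡ start
    next   : (t : ℕ) → t < n → Fin (size t) → Fin k → Fin (size (suc t))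
    out    : Fin (size n) → O

open Layers public

reachL : ∀ {n k O} (L : Layers n k O) (t : ℕ) → t ≤ n → Vec (Fin k) t → Fin (size L t)
reachL L zero    _ _  = start L
reachL L (suc t) p xs = next L t p (reachL L t (<⇒≤ p) (init xs)) (last xs)

record ROBP (n k : ℕ) (O : Set) : Set where
  field
    layers : Layers n k O
    reachable : ∀ (t : ℕ) (p : t ≤ n) (v : Fin (size layers t)) →
                ∃ λ (xs : Vec (Fin k) t) → reachL layers t p xs ≡ v

open ROBP public

sizeP : ∀ {n k O} → ROBP n k O → ℕ → ℕ
sizeP P = size (layers P)

reach : ∀ {n k O} (P : ROBP n k O) (t : ℕ) → t ≤ n → Vec (Fin k) t → Fin (sizeP P t)
reach P = reachL (layers P)

output : ∀ {n k O} (P : ROBP n k O) → Fin (sizeP P n) → O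
output P = out (layers P)

cnt : ∀ {k t} → Fin k → Vec (Fin k) t → ℕ
cnt j xs = count (λ x → x ≟ j) xs

ℕ→ℚ : ℕ → ℚ
ℕ→ℚ m = + m / 1

-- Alphabet [k] with k = suc k'; coordinates j ∈ [k-1] are Fin k',
-- coordinate j corresponding to the letter inject₁ j.
-- A rectangle ∏_j [a_j , b_j] is given by its endpoint vectors (a , b).
Rect : ℕ → Set
Rect k' = (Fin k' → ℕ) × (Fin k' → ℕ)

IsLabel : ∀ {n k' O} (P : ROBP n (suc k') O) (t : ℕ) (p : t ≤ n) →
          Fin (sizeP P t) → Rect k' → Set
IsLabel {k' = k'} P t p v (a , b) = ∀ (j : Fin k') →
    ((∃ λ xs → reach P t p xs ≡ v × cnt (inject₁ j) xs ≡ a j)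
     × (∀ xs → reach P t p xs ≡ v → a j ≤ cnt (inject₁ j) xs))
  × ((∃ λ xs → reach P t p xs ≡ v × cnt (inject₁ j) xs ≡ b j)
     × (∀ xs → reach P t p xs ≡ v → cnt (inject₁ j) xs ≤ b j))

InCollection : ∀ {n k' O} (P : ROBP n (suc k') O) (t : ℕ) (p : t ≤ n) → Rect k' → Set
InCollection P t p R = ∃ λ v → IsLabel P t p v R

Point : ℕ → Set
Point k' = Fin k' → ℚ

Subset : ℕ → Set₁
Subset k' = Point k' → Set

box : ∀ {k'} → Rect k' → Subset k'
box (a , b) x = ∀ j → (ℕ→ℚ (a j) ≤ℚ x j) × (x j ≤ℚ ℕ→ℚ (b j))

_+ₛ_ : ∀ {k'} → Subset k' → Point k' → Subset k'
(S +ₛ u) x = ∃ λ s → S s × (∀ j → x j ≡ s j + u j)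

_⊆_ : ∀ {k'} → Subset k' → Subset k' → Set
S ⊆ T = ∀ x → S x → T x

e : ∀ {k'} → Fin k' → Point k'
e i j with i ≟ j
... | yes _ = 1ℚ
... | no  _ = 0ℚ

-- equality of rectangles (as endpoint data; nonempty boxes are equal as sets iff this holds)
_≐_ : ∀ {k'} → Rect k' → Rect k' → Set
(a , b) ≐ (a' , b') = ∀ j → (a j ≡ a' j) × (b j ≡ b' j)

CardAtMost : ∀ {k'} → (Rect k' → Set) → ℕ → Set
CardAtMost {k'} C w = Σ (Fin w → Rect k') λ f → ∀ R → C R → ∃ λ i → R ≐ f i

HasWidth : ∀ {n k O} → ROBP n k O → ℕ → Set
HasWidth {n} P w = (∀ t → t ≤ n → sizeP P t ≤ w) × (∃ λ t → t ≤ n × sizeP P t ≡ w)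

ComputesApproxCount : ∀ {n k} → ROBP n k (Fin k → ℚ) → ℚ → Set
ComputesApproxCount {n} {k} P Δ =
  ∀ (x : Vec (Fin k) n) (j : Fin k) →
    ∣ output P (reach P n ≤-refl x) j - ℕ→ℚ (cnt j x) ∣ ≤ℚ Δ

-- Reading one more letter c sends every prefix reaching v to a prefix reaching the c-successor
-- of v and raises the count vector by the indicator of c, so the extreme counts at the successor
-- enclose those at v shifted by that indicator (by 0 for the last letter, by e_i for letter i).
-- Each vertex carries exactly one rectangle, so a layer has at most as many rectangles as
-- vertices. Finally, the prefixes realising a_j and b_j at a final vertex share its output,
-- which is Δ-close to both counts.
module Submission where

open import Defs
open import Data.Nat using (ℕ; suc; _≤_; _<_; z≤n)
open import Data.Nat.Properties using (<⇒≤; ≤-refl)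
open import Data.Fin using (Fin)
open import Data.Rational using (ℚ; _-_; _+_) renaming (_≤_ to _≤ℚ_)
open import Data.Product using (∃; _×_; _,_)
open import Relation.Binary.PropositionalEquality using (_≡_)

import Data.Nat as ℕ
import Data.Nat.Properties as ℕ
import Data.Nat.Coprimality as Coprime
import Data.Integer as ℤ
import Data.Integer.Properties as ℤ
open import Data.Rational using (mkℚ; _/_; 0ℚ; ∣_∣; *≤*)
open import Data.Rational.Properties as ℚ
  using (normalize-coprime; /-cong; 0≤∣p∣; nonPositive⁻¹; ∣p-q∣≤∣p∣+∣q∣; +-mono-≤; +-monoˡ-≤)
open import Data.Rational.Solver using (module +-*-Solver)
open import Data.Fin using (inject₁; fromℕ; toℕ; fromℕ<; inject≤; _≟_)
open import Data.Fin.Properties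
  using (fromℕ≢inject₁; inject₁-injective; toℕ-injective; toℕ-inject≤; toℕ-fromℕ<; toℕ<n)
open import Data.Vec using (Vec; []; _∷_; _∷ʳ_)
open import Data.Vec.Properties using (init-∷ʳ; last-∷ʳ)
open import Data.List using (List; [_]; filter; cartesianProductWith; allFin)
open import Data.List.Membership.Propositional using (_∈_)
open import Data.List.Membership.Propositional.Properties
  using (∈-filter⁺; ∈-cartesianProductWith⁺; ∈-allFin)
open import Data.List.Relation.Unary.Any using (here)
import Data.List.Relation.Unary.All as All
open import Data.List.Relation.Unary.All.Properties using (all-filter)
open import Data.List.Extrema.Nat
  using (argmin; argmax; argmin-all; argmax-all; f[argmin]≤f[xs]; f[xs]≤f[argmax])
open import Data.Product using (proj₁; proj₂)
open import Data.Bool using (true; false)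
open import Data.Empty using (⊥-elim)
open import Function using (_∘_)
open import Level using (0ℓ)
open import Relation.Nullary using (yes; no; does)
open import Relation.Unary using (Pred; Decidable)
open import Relation.Binary.PropositionalEquality
  using (refl; sym; trans; cong; cong₂; subst; subst₂; module ≡-Reasoning)

ℕ→ℚ≡mkℚ : ∀ m → ℕ→ℚ m ≡ mkℚ (ℤ.+ m) 0 (Coprime.sym (Coprime.1-coprimeTo m))
ℕ→ℚ≡mkℚ m = normalize-coprime (Coprime.sym (Coprime.1-coprimeTo m))

ℕ→ℚ-mono-≤ : ∀ {m n} → m ≤ n → ℕ→ℚ m ≤ℚ ℕ→ℚ n
ℕ→ℚ-mono-≤ {m} {n} m≤n rewrite ℕ→ℚ≡mkℚ m | ℕ→ℚ≡mkℚ n =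
  *≤* (subst₂ ℤ._≤_ (sym (ℤ.*-identityʳ (ℤ.+ m))) (sym (ℤ.*-identityʳ (ℤ.+ n))) (ℤ.+≤+ m≤n))

ℕ→ℚ-homo-+ : ∀ m n → ℕ→ℚ (m ℕ.+ n) ≡ ℕ→ℚ m + ℕ→ℚ n
ℕ→ℚ-homo-+ m n = begin
  ℕ→ℚ (m ℕ.+ n)                              ≡⟨ /-cong m+n≡m*1+n*1 refl ⟩
  (ℤ.+ m ℤ.* ℤ.+ 1 ℤ.+ ℤ.+ n ℤ.* ℤ.+ 1) / 1  ≡⟨ cong₂ _+_ (ℕ→ℚ≡mkℚ m) (ℕ→ℚ≡mkℚ n) ⟨
  ℕ→ℚ m + ℕ→ℚ n                              ∎
  where
  open ≡-Reasoning
  m+n≡m*1+n*1 : ℤ.+ (m ℕ.+ n) ≡ ℤ.+ m ℤ.* ℤ.+ 1 ℤ.+ ℤ.+ n ℤ.* ℤ.+ 1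
  m+n≡m*1+n*1 = sym (cong₂ ℤ._+_ (ℤ.*-identityʳ (ℤ.+ m)) (ℤ.*-identityʳ (ℤ.+ n)))

p≤∣p∣ : ∀ p → p ≤ℚ ∣ p ∣
p≤∣p∣ (mkℚ (ℤ.+ _) _ _)      = ℚ.≤-refl
p≤∣p∣ p@(mkℚ ℤ.-[1+ _ ] _ _) = ℚ.≤-trans (nonPositive⁻¹ p) (0≤∣p∣ p)

q-p≤∣o-p∣+∣o-q∣ : ∀ o p q → q - p ≤ℚ ∣ o - p ∣ + ∣ o - q ∣
q-p≤∣o-p∣+∣o-q∣ o p q = begin
  q - p                 ≡⟨ difference-of-differences ⟨
  (o - p) - (o - q)     ≤⟨ p≤∣p∣ _ ⟩
  ∣ (o - p) - (o - q) ∣ ≤⟨ ∣p-q∣≤∣p∣+∣q∣ (o - p) (o - q) ⟩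
  ∣ o - p ∣ + ∣ o - q ∣ ∎
  where
  open ℚ.≤-Reasoning
  difference-of-differences : (o - p) - (o - q) ≡ q - p
  difference-of-differences = solve 3 (λ o p q → (o :- p) :- (o :- q) := q :- p) refl o p q
    where open +-*-Solver

+ₛ-identityʳ-⊇ : ∀ {k'} {S : Subset k'} {u : Point k'} → (∀ j → u j ≡ 0ℚ) → S ⊆ (S +ₛ u)
+ₛ-identityʳ-⊇ u≡0 x x∈S = x , x∈S , λ j → sym (trans (cong (x j +_) (u≡0 j)) (ℚ.+-identityʳ (x j)))

+ₛ-cong-⊆ : ∀ {k'} {S : Subset k'} {u u' : Point k'} → (∀ j → u j ≡ u' j) → (S +ₛ u) ⊆ (S +ₛ u')
+ₛ-cong-⊆ u≡u' x (s , s∈S , x≡s+u) = s , s∈S , λ j → trans (x≡s+u j) (cong (s j +_) (u≡u' j))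

box-+ₛ-⊆ : ∀ {k'} {a b a' b' d : Fin k' → ℕ} →
  (∀ j → a' j ≤ a j ℕ.+ d j) → (∀ j → b j ℕ.+ d j ≤ b' j) →
  (box (a , b) +ₛ (ℕ→ℚ ∘ d)) ⊆ box (a' , b')
box-+ₛ-⊆ {a = a} {b} {a'} {b'} {d} a'≤a+d b+d≤b' x (s , s∈R , x≡s+d) j = lower , upper
  where
  open ℚ.≤-Reasoning
  lower : ℕ→ℚ (a' j) ≤ℚ x j
  lower = begin
    ℕ→ℚ (a' j)            ≤⟨ ℕ→ℚ-mono-≤ (a'≤a+d j) ⟩
    ℕ→ℚ (a j ℕ.+ d j)     ≡⟨ ℕ→ℚ-homo-+ (a j) (d j) ⟩
    ℕ→ℚ (a j) + ℕ→ℚ (d j) ≤⟨ +-monoˡ-≤ (ℕ→ℚ (d j)) (proj₁ (s∈R j)) ⟩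
    s j + ℕ→ℚ (d j)       ≡⟨ x≡s+d j ⟨
    x j                   ∎
  upper : x j ≤ℚ ℕ→ℚ (b' j)
  upper = begin
    x j                   ≡⟨ x≡s+d j ⟩
    s j + ℕ→ℚ (d j)       ≤⟨ +-monoˡ-≤ (ℕ→ℚ (d j)) (proj₂ (s∈R j)) ⟩
    ℕ→ℚ (b j) + ℕ→ℚ (d j) ≡⟨ ℕ→ℚ-homo-+ (b j) (d j) ⟨
    ℕ→ℚ (b j ℕ.+ d j)     ≤⟨ ℕ→ℚ-mono-≤ (b+d≤b' j) ⟩
    ℕ→ℚ (b' j)            ∎

origin : ∀ {k'} → Rect k'
origin = (λ _ → 0) , (λ _ → 0)

CardAtMost-mono : ∀ {k'} {C : Rect k' → Set} {m w} → m ≤ w → CardAtMost C m → CardAtMost C w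
CardAtMost-mono {m = m} {w} m≤w (f , covers) = g , λ R R∈C → lift (covers R R∈C)
  where
  g : Fin w → Rect _
  g i with toℕ i ℕ.<? m
  ... | yes i<m = f (fromℕ< i<m)
  ... | no  _   = origin
  g-inject≤ : ∀ i → g (inject≤ i m≤w) ≡ f i
  g-inject≤ i with toℕ (inject≤ i m≤w) ℕ.<? m
  ... | yes i<m = cong f (toℕ-injective (trans (toℕ-fromℕ< i<m) (toℕ-inject≤ i m≤w)))
  ... | no  i≮m = ⊥-elim (i≮m (subst (ℕ._< m) (sym (toℕ-inject≤ i m≤w)) (toℕ<n i)))
  lift : ∀ {R} → ∃ (λ i → R ≐ f i) → ∃ (λ i → R ≐ g i)
  lift (i , R≐fi) = inject≤ i m≤w , subst (_ ≐_) (sym (g-inject≤ i)) R≐fi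

vectors : ∀ k t → List (Vec (Fin k) t)
vectors k ℕ.zero  = [ [] ]
vectors k (suc t) = cartesianProductWith _∷_ (allFin k) (vectors k t)

∈-vectors : ∀ {k t} (xs : Vec (Fin k) t) → xs ∈ vectors k t
∈-vectors []       = here refl
∈-vectors (x ∷ xs) = ∈-cartesianProductWith⁺ _∷_ (∈-allFin x) (∈-vectors xs)

module _ {A : Set} {xs : List A} (xs-complete : ∀ x → x ∈ xs)
         {Q : Pred A 0ℓ} (Q? : Decidable Q) (f : A → ℕ) where

  minimiser : ∃ Q → ∃ λ x → Q x × (∀ y → Q y → f x ≤ f y)
  minimiser (x₀ , Qx₀) = argmin f x₀ ys , argmin-all f Qx₀ (all-filter Q? xs) ,
    λ y Qy → All.lookup (f[argmin]≤f[xs] x₀ ys) (∈-filter⁺ Q? (xs-complete y) Qy)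
    where ys = filter Q? xs

  maximiser : ∃ Q → ∃ λ x → Q x × (∀ y → Q y → f y ≤ f x)
  maximiser (x₀ , Qx₀) = argmax f x₀ ys , argmax-all f Qx₀ (all-filter Q? xs) ,
    λ y Qy → All.lookup (f[xs]≤f[argmax] x₀ ys) (∈-filter⁺ Q? (xs-complete y) Qy)
    where ys = filter Q? xs

cnt-∷ʳ : ∀ {k t} (j c : Fin k) (xs : Vec (Fin k) t) → cnt j (xs ∷ʳ c) ≡ cnt j xs ℕ.+ cnt j (c ∷ [])
cnt-∷ʳ j c []       = refl
cnt-∷ʳ j c (x ∷ xs) with does (x ≟ j)
... | true  = cong suc (cnt-∷ʳ j c xs)
... | false = cnt-∷ʳ j c xs

increment : ∀ {k'} → Fin (suc k') → Fin k' → ℕ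
increment c j = cnt (inject₁ j) (c ∷ [])

increment-fromℕ : ∀ {k'} (j : Fin k') → increment (fromℕ k') j ≡ 0
increment-fromℕ j with fromℕ _ ≟ inject₁ j
... | yes n≡j = ⊥-elim (fromℕ≢inject₁ n≡j)
... | no  _   = refl

e≡increment-inject₁ : ∀ {k'} (i j : Fin k') → e i j ≡ ℕ→ℚ (increment (inject₁ i) j)
e≡increment-inject₁ i j with i ≟ j | inject₁ i ≟ inject₁ j
... | yes _   | yes _   = refl
... | no  _   | no  _   = refl
... | yes i≡j | no  i≢j = ⊥-elim (i≢j (cong inject₁ i≡j))
... | no  i≢j | yes i≡j = ⊥-elim (i≢j (inject₁-injective i≡j))

module _ {n k' O} (P : ROBP n (suc k') O) where

  reach-∷ʳ : ∀ {t} (p : t < n) xs c →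
    reach P (suc t) p (xs ∷ʳ c) ≡ next (layers P) t p (reach P t (<⇒≤ p) xs) c
  reach-∷ʳ p xs c rewrite init-∷ʳ c xs | last-∷ʳ c xs = refl

  origin-∈-𝓡₀ : InCollection P 0 z≤n origin
  origin-∈-𝓡₀ = start (layers P) , λ _ →
    (([] , refl , refl) , λ _ _ → z≤n) , (([] , refl , refl) , λ { [] _ → z≤n })

  𝓡₀-origin : ∀ R → InCollection P 0 z≤n R → R ≐ origin
  𝓡₀-origin R (v , l) j with l j
  ... | (([] , _ , cnt≡a) , _) , (([] , _ , cnt≡b) , _) = sym cnt≡a , sym cnt≡b

  label-exists : ∀ t (p : t ≤ n) v → ∃ (IsLabel P t p v)
  label-exists t p v = (proj₁ ∘ least , proj₁ ∘ greatest) , λ j → proj₂ (least j) , proj₂ (greatest j)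
    where
    Reaches : Pred (Vec (Fin (suc k')) t) 0ℓ
    Reaches xs = reach P t p xs ≡ v
    reaches? : Decidable Reaches
    reaches? xs = reach P t p xs ≟ v
    Attained : Fin k' → ℕ → Set
    Attained j m = ∃ λ xs → Reaches xs × cnt (inject₁ j) xs ≡ m
    least : ∀ j → ∃ λ m → Attained j m × (∀ xs → Reaches xs → m ≤ cnt (inject₁ j) xs)
    least j with minimiser ∈-vectors reaches? (cnt (inject₁ j)) (reachable P t p v)
    ... | xs , reaches , minimal = cnt (inject₁ j) xs , (xs , reaches , refl) , minimal
    greatest : ∀ j → ∃ λ m → Attained j m × (∀ xs → Reaches xs → cnt (inject₁ j) xs ≤ m)
    greatest j with maximiser ∈-vectors reaches? (cnt (inject₁ j)) (reachable P t p v)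
    ... | xs , reaches , maximal = cnt (inject₁ j) xs , (xs , reaches , refl) , maximal

  label-unique : ∀ {t p v R R'} → IsLabel P t p v R → IsLabel P t p v R' → R ≐ R'
  label-unique l l' j with l j | l' j
  ... | ((xa , ra , ≡a) , a≤) , ((xb , rb , ≡b) , ≤b) | ((xa' , ra' , ≡a') , a'≤) , ((xb' , rb' , ≡b') , ≤b') =
    ℕ.≤-antisym (subst (_ ≤_) ≡a' (a≤ xa' ra')) (subst (_ ≤_) ≡a (a'≤ xa ra)) ,
    ℕ.≤-antisym (subst (_≤ _) ≡b (≤b' xb rb)) (subst (_≤ _) ≡b' (≤b xb' rb'))

  labels-cardinality : ∀ t (p : t ≤ n) → CardAtMost (InCollection P t p) (sizeP P t)
  labels-cardinality t p = proj₁ ∘ label-exists t p ,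
    λ R (v , l) → v , label-unique l (proj₂ (label-exists t p v))

  label-step : ∀ {t} (p : t < n) {v a b a' b'} c →
    IsLabel P t (<⇒≤ p) v (a , b) → IsLabel P (suc t) p (next (layers P) t p v c) (a' , b') →
    ∀ j → a' j ≤ a j ℕ.+ increment c j × b j ℕ.+ increment c j ≤ b' j
  label-step {t} p {v} {a' = a'} {b'} c l l' j with l j | l' j
  ... | ((xa , ra , ≡a) , _) , ((xb , rb , ≡b) , _) | (_ , a'≤) , (_ , ≤b') =
    subst (a' j ≤_) (count-after xa ≡a) (a'≤ (xa ∷ʳ c) (step ra)) ,
    subst (_≤ b' j) (count-after xb ≡b) (≤b' (xb ∷ʳ c) (step rb))
    where
    step : ∀ {xs} → reach P t (<⇒≤ p) xs ≡ v → reach P (suc t) p (xs ∷ʳ c) ≡ next (layers P) t p v c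
    step {xs} r = trans (reach-∷ʳ p xs c) (cong (λ u → next (layers P) t p u c) r)
    count-after : ∀ (xs : Vec (Fin (suc k')) t) {m} → cnt (inject₁ j) xs ≡ m → cnt (inject₁ j) (xs ∷ʳ c) ≡ m ℕ.+ increment c j
    count-after xs refl = cnt-∷ʳ (inject₁ j) c xs

  successor-covers : ∀ {t} (p : t < n) {R} → InCollection P t (<⇒≤ p) R → ∀ c →
    ∃ λ R' → InCollection P (suc t) p R' × (box R +ₛ (ℕ→ℚ ∘ increment c)) ⊆ box R'
  successor-covers {t} p {a , b} (v , l) c with label-exists (suc t) p (next (layers P) t p v c)
  ... | R'@(a' , b') , l' = R' , (_ , l') , box-+ₛ-⊆ {d = increment c} (proj₁ ∘ bounds) (proj₂ ∘ bounds)
    where bounds = label-step p c l l'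

  successor-covers-box : ∀ {t} (p : t < n) {R} → InCollection P t (<⇒≤ p) R →
    ∃ λ R' → InCollection P (suc t) p R' × box R ⊆ box R'
  successor-covers-box p R∈ with successor-covers p R∈ (fromℕ k')
  ... | R' , R'∈ , ⊆R' = R' , R'∈ , λ x → ⊆R' x ∘ +ₛ-identityʳ-⊇ (cong ℕ→ℚ ∘ increment-fromℕ) x

  successor-covers-+e : ∀ {t} (p : t < n) {R} → InCollection P t (<⇒≤ p) R → ∀ i →
    ∃ λ R' → InCollection P (suc t) p R' × (box R +ₛ e i) ⊆ box R'
  successor-covers-+e p R∈ i with successor-covers p R∈ (inject₁ i)
  ... | R' , R'∈ , ⊆R' = R' , R'∈ , λ x → ⊆R' x ∘ +ₛ-cong-⊆ (e≡increment-inject₁ i) x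

final-label-spread : ∀ {n k'} {P : ROBP n (suc k') (Fin (suc k') → ℚ)} {Δ v a b} →
  ComputesApproxCount P Δ → IsLabel P n ≤-refl v (a , b) →
  ∀ j → ℕ→ℚ (b j) - ℕ→ℚ (a j) ≤ℚ Δ + Δ
final-label-spread {P = P} {Δ} {v} {a} {b} approx l j with l j
... | ((xa , ra , ≡a) , _) , ((xb , rb , ≡b) , _) = begin
  ℕ→ℚ (b j) - ℕ→ℚ (a j)                 ≤⟨ q-p≤∣o-p∣+∣o-q∣ o (ℕ→ℚ (a j)) (ℕ→ℚ (b j)) ⟩
  ∣ o - ℕ→ℚ (a j) ∣ + ∣ o - ℕ→ℚ (b j) ∣ ≤⟨ +-mono-≤ (close xa ra ≡a) (close xb rb ≡b) ⟩
  Δ + Δ                                 ∎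
  where
  open ℚ.≤-Reasoning
  o : ℚ
  o = output P v (inject₁ j)
  close : ∀ xs {m} → reach P _ ≤-refl xs ≡ v → cnt (inject₁ j) xs ≡ m → ∣ o - ℕ→ℚ m ∣ ≤ℚ Δ
  close xs reaches counts =
    subst₂ (λ u m → ∣ output P u (inject₁ j) - ℕ→ℚ m ∣ ≤ℚ Δ) reaches counts (approx xs (inject₁ j))

proposition4p3 : ∀ {n k' : ℕ} → 1 ≤ k' → (P : ROBP n (suc k') (Fin (suc k') → ℚ)) →
    ((InCollection P 0 z≤n ((λ _ → 0) , (λ _ → 0))
      × (∀ R → InCollection P 0 z≤n R → R ≐ ((λ _ → 0) , (λ _ → 0))))
     × (∀ (t : ℕ) (p : t < n) (R : Rect k') → InCollection P t (<⇒≤ p) R →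
          (∃ λ R' → InCollection P (suc t) p R' × (box R ⊆ box R'))
          × (∀ (i : Fin k') → ∃ λ R' → InCollection P (suc t) p R'
                                × ((box R +ₛ e i) ⊆ box R'))))
    × (∀ (w : ℕ) → HasWidth P w → ∀ (t : ℕ) (p : t ≤ n) → CardAtMost (InCollection P t p) w)
    × (∀ (Δ : ℚ) → ComputesApproxCount P Δ → ∀ (a b : Fin k' → ℕ) →
         InCollection P n ≤-refl (a , b) →
         ∀ (j : Fin k') → ℕ→ℚ (b j) - ℕ→ℚ (a j) ≤ℚ Δ + Δ)
proposition4p3 _ P =
  ( (origin-∈-𝓡₀ P , 𝓡₀-origin P)
  , λ t p R R∈𝓡ₜ → successor-covers-box P p R∈𝓡ₜ , successor-covers-+e P p R∈𝓡ₜ)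
  , (λ w (layers≤w , _) t p → CardAtMost-mono (layers≤w t p) (labels-cardinality P t p))
  , λ Δ approx a b (v , l) → final-label-spread {P = P} approx l
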